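{- Let $v,w$ be terms of $\overline{\lambda}\mu\tilde{\mu}^*$. (1) If $v\hookrightarrow_r w$ for $r$ one of the rules $\lambda,\mu,\tilde\mu,s_l,s_r$, then $v^{\mathfrak e}\to^+w^{\mathfrak e}$ in $\lambda^{Sym}_{Prop}$. (2) If $v\hookrightarrow_r w$ for $r$ one of the rules $cl_{1,l},cl_{1,r},cl_2$, then $v^{\mathfrak e}\sim w^{\mathfrak e}$.
   Context: $\overline{\lambda}\mu\tilde{\mu}^*$ terms: $p::=\lfloor t,e\rfloor$; $t::=x\mid\lambda x\,t\mid\mu\alpha\,p\mid\overline{e}$; $e::=\alpha\mid(t.e)\mid\tilde{\mu}x\,p\mid\widetilde{t}$ ($x$ $l$-variables, $\alpha$ $r$-variables). $\hookrightarrow_r$ is the compatible closure of rule $r$: ($\lambda$) $\lfloor\lambda x\,t,(t'.e)\rfloor\hookrightarrow\lfloor t',\tilde{\mu}x\lfloor t,e\rfloor\rfloor$; ($\mu$) $\lfloor\mu\alpha\,p,e\rfloor\hookrightarrow p[\alpha:=e]$; ($\tilde\mu$) $\lfloor t,\tilde{\mu}x\,p\rfloor\hookrightarrow p[x:=t]$; ($s_l$) $\mu\alpha\lfloor t,\alpha\rfloor\hookrightarrow t$ if $\alpha\notin Fv(t)$; ($s_r$) $\tilde{\mu}x\lfloor x,e\rfloor\hookrightarrow e$ if $x\notin Fv(e)$; ($cl_{1,l}$) $\overline{\widetilde{t}}\hookrightarrow t$; ($cl_{1,r}$) $\widetilde{\overline{e}}\hookrightarrow e$; ($cl_2$) $\lfloor\overline{e},\widetilde{t}\rfloor\hookrightarrow\lfloor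 t,e\rfloor$. $\lambda^{Sym}_{Prop}$ terms are built from variables by $\langle P_1,P_2\rangle$, $\sigma_i(P)$, $\lambda xP$, $(P_1\star P_2)$; $\to$ is the compatible closure of: $(\lambda xP\star Q)\to P[x:=Q]$; $(Q\star\lambda xP)\to P[x:=Q]$; $\lambda x(P\star x)\to P$ and $\lambda x(x\star P)\to P$ if $x\notin Fv(P)$; $(\langle P_1,P_2\rangle\star\sigma_i(Q))\to(P_i\star Q)$; $(\sigma_i(Q)\star\langle P_1,P_2\rangle)\to(Q\star P_i)$; and the rule $E[P]\to P$ for one-hole contexts $E[-]\neq[-]$ of type $\bot$ with $P$ of type $\bot$ and no free variable of $P$ bound by $E$. $\sim$ is the smallest relation with $x\sim x$; $M\sim M'\Rightarrow\lambda xM\sim\lambda xM',\ \sigma_i(M)\sim\sigma_i(M')$; $M\sim M',N\sim N'\Rightarrow\langle M,N\rangle\sim\langle M',N'\rangle,\ (M\star N)\sim(M'\star N'),\ (M\star N)\sim(N'\star M')$. Translation $\cdot^{\mathfrak e}$: each $r$-variable $\alpha$ has an associated variable $\overline{\alpha}$ of $\lambda^{Sym}_{Prop}$; $\pi_i(y)=\lambda z(y\star\sigma_i(z))$; $\lfloor v,u\rfloor^{\mathfrak e}=(u^{\mathfrak e}\star v^{\mathfrak e})$; $x^{\mathfrak e}=x$; $(\lambda x\,u)^{\mathfrak e}=\lambda y(\lambda x(\pi_2(y)\star u^{\mathfrak e})\star\pi_1(y))$ ($y,z$ fresh); $(\mu\alpha\,p)^{\mathfrak e}=\lambda\overline{\alpha}\,p^{\mathfrak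 e}$; $(\overline{h})^{\mathfrak e}=h^{\mathfrak e}$; $\alpha^{\mathfrak e}=\overline{\alpha}$; $(t.h)^{\mathfrak e}=\langle t^{\mathfrak e},h^{\mathfrak e}\rangle$; $(\tilde\mu x\,p)^{\mathfrak e}=\lambda x\,p^{\mathfrak e}$; $(\widetilde{u})^{\mathfrak e}=u^{\mathfrak e}$. -}

module Defs where

open import Data.Nat using (ℕ; zero; suc; _+_)
import Data.Fin as Fin
open import Data.Fin using (Fin; zero; suc; _↑ˡ_; _↑ʳ_)
open import Function using (_∘_)
open import Relation.Binary.Construct.Closure.Transitive using (TransClosure)

-- λSym_Prop : well-scoped de Bruijn terms (k = number of free variables)

-- index i ∈ {1,2} of σᵢ / πᵢ is Fin 2 (zero = 1, suc zero = 2)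
data Sym : ℕ → Set where
  sv   : ∀ {k} → Fin k → Sym k
  ⟨_,_⟩ : ∀ {k} → Sym k → Sym k → Sym k
  σ    : ∀ {k} → Fin 2 → Sym k → Sym k
  ƛ    : ∀ {k} → Sym (suc k) → Sym k
  _⋆_  : ∀ {k} → Sym k → Sym k → Sym k

pick : ∀ {A : Set} → Fin 2 → A → A → A
pick zero    a b = a
pick (suc _) a b = b

extR : ∀ {k k'} → (Fin k → Fin k') → Fin (suc k) → Fin (suc k')
extR ρ zero    = zero
extR ρ (suc i) = suc (ρ i)

ren : ∀ {k k'} → (Fin k → Fin k') → Sym k → Sym k'
ren ρ (sv x)      = sv (ρ x)
ren ρ ⟨ P , Q ⟩   = ⟨ ren ρ P , ren ρ Q ⟩
ren ρ (σ i P)     = σ i (ren ρ P)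
ren ρ (ƛ P)       = ƛ (ren (extR ρ) P)
ren ρ (P ⋆ Q)     = ren ρ P ⋆ ren ρ Q

exts : ∀ {k k'} → (Fin k → Sym k') → Fin (suc k) → Sym (suc k')
exts s zero    = sv zero
exts s (suc i) = ren suc (s i)

sub : ∀ {k k'} → (Fin k → Sym k') → Sym k → Sym k'
sub s (sv x)      = s x
sub s ⟨ P , Q ⟩   = ⟨ sub s P , sub s Q ⟩
sub s (σ i P)     = σ i (sub s P)
sub s (ƛ P)       = ƛ (sub (exts s) P)
sub s (P ⋆ Q)     = sub s P ⋆ sub s Q

sub0 : ∀ {k} → Sym k → Fin (suc k) → Sym k
sub0 Q zero    = Q
sub0 Q (suc i) = sv i

_[0≔_] : ∀ {k} → Sym (suc k) → Sym k → Sym k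
P [0≔ Q ] = sub (sub0 Q) P

-- one-hole contexts: outer scope k, scope at the hole k'
data SCtx : ℕ → ℕ → Set where
  hole  : ∀ {k} → SCtx k k
  ƛC    : ∀ {k k'} → SCtx (suc k) k' → SCtx k k'
  pairL : ∀ {k k'} → SCtx k k' → Sym k → SCtx k k'
  pairR : ∀ {k k'} → Sym k → SCtx k k' → SCtx k k'
  σC    : ∀ {k k'} → Fin 2 → SCtx k k' → SCtx k k'
  starL : ∀ {k k'} → SCtx k k' → Sym k → SCtx k k'
  starR : ∀ {k k'} → Sym k → SCtx k k' → SCtx k k'

plug : ∀ {k k'} → SCtx k k' → Sym k' → Sym k
plug hole        P = P
plug (ƛC E)      P = ƛ (plug E P)
plug (pairL E Q) P = ⟨ plug E P , Q ⟩
plug (pairR Q E) P = ⟨ Q , plug E P ⟩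
plug (σC i E)    P = σ i (plug E P)
plug (starL E Q) P = plug E P ⋆ Q
plug (starR Q E) P = Q ⋆ plug E P

-- the weakening of the outer scope into the scope at the hole
-- (skipping the variables bound by E)
bindersWk : ∀ {k k'} → SCtx k k' → Fin k → Fin k'
bindersWk hole        = λ i → i
bindersWk (ƛC E)      = λ i → bindersWk E (Fin.suc i)
bindersWk (pairL E _) = bindersWk E
bindersWk (pairR _ E) = bindersWk E
bindersWk (σC _ E)    = bindersWk E
bindersWk (starL E _) = bindersWk E
bindersWk (starR _ E) = bindersWk E

-- "has type ⊥": in λSym_Prop the only terms of type ⊥ are products (P ⋆ Q)
data IsBot {k} : Sym k → Set where
  isBot : (P Q : Sym k) → IsBot (P ⋆ Q)

data NonHole : ∀ {k k'} → SCtx k k' → Set where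
  nonHole-ƛ     : ∀ {k k'} (E : SCtx (suc k) k') → NonHole (ƛC E)
  nonHole-pairL : ∀ {k k'} (E : SCtx k k') Q → NonHole (pairL E Q)
  nonHole-pairR : ∀ {k k'} Q (E : SCtx k k') → NonHole (pairR Q E)
  nonHole-σ     : ∀ {k k'} i (E : SCtx k k') → NonHole (σC i E)
  nonHole-starL : ∀ {k k'} (E : SCtx k k') Q → NonHole (starL E Q)
  nonHole-starR : ∀ {k k'} Q (E : SCtx k k') → NonHole (starR Q E)

-- the basic reduction rules of λSym_Prop
-- (x ∉ Fv(P) is expressed by P being a weakening  ren suc P)
data SymTop {k} : Sym k → Sym k → Set where
  βl   : ∀ P Q → SymTop (ƛ P ⋆ Q) (P [0≔ Q ])
  βr   : ∀ P Q → SymTop (Q ⋆ ƛ P) (P [0≔ Q ])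
  ηl   : ∀ P → SymTop (ƛ (ren suc P ⋆ sv zero)) P
  ηr   : ∀ P → SymTop (ƛ (sv zero ⋆ ren suc P)) P
  πl   : ∀ i P₁ P₂ Q → SymTop (⟨ P₁ , P₂ ⟩ ⋆ σ i Q) (pick i P₁ P₂ ⋆ Q)
  πr   : ∀ i P₁ P₂ Q → SymTop (σ i Q ⋆ ⟨ P₁ , P₂ ⟩) (Q ⋆ pick i P₁ P₂)
  -- E[P] → P : E ≠ [-], E[P] and P of type ⊥, no free variable of P bound by E
  ⊥r   : ∀ {k'} (E : SCtx k k') (P : Sym k) → NonHole E → IsBot P →
         IsBot (plug E (ren (bindersWk E) P)) →
         SymTop (plug E (ren (bindersWk E) P)) P

infix 4 _⟶_
data _⟶_ : ∀ {k} → Sym k → Sym k → Set where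
  top   : ∀ {k} {P Q : Sym k} → SymTop P Q → P ⟶ Q
  ƛ-c   : ∀ {k} {P P' : Sym (suc k)} → P ⟶ P' → ƛ P ⟶ ƛ P'
  σ-c   : ∀ {k} i {P P' : Sym k} → P ⟶ P' → σ i P ⟶ σ i P'
  pairl : ∀ {k} {P P' : Sym k} Q → P ⟶ P' → ⟨ P , Q ⟩ ⟶ ⟨ P' , Q ⟩
  pairr : ∀ {k} {P P' : Sym k} Q → P ⟶ P' → ⟨ Q , P ⟩ ⟶ ⟨ Q , P' ⟩
  starl : ∀ {k} {P P' : Sym k} Q → P ⟶ P' → (P ⋆ Q) ⟶ (P' ⋆ Q)
  starr : ∀ {k} {P P' : Sym k} Q → P ⟶ P' → (Q ⋆ P) ⟶ (Q ⋆ P')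

infix 4 _⟶⁺_
_⟶⁺_ : ∀ {k} → Sym k → Sym k → Set
_⟶⁺_ {k} = TransClosure (_⟶_ {k})

infix 4 _∼_
data _∼_ : ∀ {k} → Sym k → Sym k → Set where
  var∼  : ∀ {k} (x : Fin k) → sv x ∼ sv x
  ƛ∼    : ∀ {k} {M M' : Sym (suc k)} → M ∼ M' → ƛ M ∼ ƛ M'
  σ∼    : ∀ {k} i {M M' : Sym k} → M ∼ M' → σ i M ∼ σ i M'
  pair∼ : ∀ {k} {M M' N N' : Sym k} → M ∼ M' → N ∼ N' → ⟨ M , N ⟩ ∼ ⟨ M' , N' ⟩
  star∼ : ∀ {k} {M M' N N' : Sym k} → M ∼ M' → N ∼ N' → (M ⋆ N) ∼ (M' ⋆ N')
  swap∼ : ∀ {k} {M M' N N' : Sym k} → M ∼ M' → N ∼ N' → (M ⋆ N) ∼ (N' ⋆ M')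

-- λ̄μμ̃* : well-scoped de Bruijn syntax, m l-variables and n r-variables

data Sort : Set where
  cmd trm ctx : Sort      -- p (commands), t (terms), e (environments)

data Exp : Sort → ℕ → ℕ → Set where
  cut  : ∀ {m n} → Exp trm m n → Exp ctx m n → Exp cmd m n   -- ⌊t,e⌋
  lv   : ∀ {m n} → Fin m → Exp trm m n
  lam  : ∀ {m n} → Exp trm (suc m) n → Exp trm m n
  mu   : ∀ {m n} → Exp cmd m (suc n) → Exp trm m n
  bar  : ∀ {m n} → Exp ctx m n → Exp trm m n                   -- ē
  rv   : ∀ {m n} → Fin n → Exp ctx m n
  push : ∀ {m n} → Exp trm m n → Exp ctx m n → Exp ctx m n     -- (t.e)
  mut  : ∀ {m n} → Exp cmd (suc m) n → Exp ctx m n             -- μ̃x p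
  tld  : ∀ {m n} → Exp trm m n → Exp ctx m n                   -- t̃

renL : ∀ {s m m' n} → (Fin m → Fin m') → Exp s m n → Exp s m' n
renL ρ (cut t e)   = cut (renL ρ t) (renL ρ e)
renL ρ (lv x)      = lv (ρ x)
renL ρ (lam t)     = lam (renL (extR ρ) t)
renL ρ (mu p)      = mu (renL ρ p)
renL ρ (bar e)     = bar (renL ρ e)
renL ρ (rv a)      = rv a
renL ρ (push t e)  = push (renL ρ t) (renL ρ e)
renL ρ (mut p)     = mut (renL (extR ρ) p)
renL ρ (tld t)     = tld (renL ρ t)

renR : ∀ {s m n n'} → (Fin n → Fin n') → Exp s m n → Exp s m n'
renR ρ (cut t e)   = cut (renR ρ t) (renR ρ e)
renR ρ (lv x)      = lv x
renR ρ (lam t)     = lam (renR ρ t)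
renR ρ (mu p)      = mu (renR (extR ρ) p)
renR ρ (bar e)     = bar (renR ρ e)
renR ρ (rv a)      = rv (ρ a)
renR ρ (push t e)  = push (renR ρ t) (renR ρ e)
renR ρ (mut p)     = mut (renR ρ p)
renR ρ (tld t)     = tld (renR ρ t)

extsL : ∀ {m m' n} → (Fin m → Exp trm m' n) → Fin (suc m) → Exp trm (suc m') n
extsL s zero    = lv zero
extsL s (suc i) = renL suc (s i)

extsR : ∀ {m n n'} → (Fin n → Exp ctx m n') → Fin (suc n) → Exp ctx m (suc n')
extsR s zero    = rv zero
extsR s (suc i) = renR suc (s i)

substL : ∀ {s m m' n} → (Fin m → Exp trm m' n) → Exp s m n → Exp s m' n
substL σ' (cut t e)  = cut (substL σ' t) (substL σ' e)
substL σ' (lv x)     = σ' x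
substL σ' (lam t)    = lam (substL (extsL σ') t)
substL σ' (mu p)     = mu (substL (λ i → renR Fin.suc (σ' i)) p)
substL σ' (bar e)    = bar (substL σ' e)
substL σ' (rv a)     = rv a
substL σ' (push t e) = push (substL σ' t) (substL σ' e)
substL σ' (mut p)    = mut (substL (extsL σ') p)
substL σ' (tld t)    = tld (substL σ' t)

substR : ∀ {s m n n'} → (Fin n → Exp ctx m n') → Exp s m n → Exp s m n'
substR σ' (cut t e)  = cut (substR σ' t) (substR σ' e)
substR σ' (lv x)     = lv x
substR σ' (lam t)    = lam (substR (λ i → renL Fin.suc (σ' i)) t)
substR σ' (mu p)     = mu (substR (extsR σ') p)
substR σ' (bar e)    = bar (substR σ' e)
substR σ' (rv a)     = σ' a
substR σ' (push t e) = push (substR σ' t) (substR σ' e)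
substR σ' (mut p)    = mut (substR (λ i → renL Fin.suc (σ' i)) p)
substR σ' (tld t)    = tld (substR σ' t)

substL0 : ∀ {s m n} → Exp trm m n → Exp s (suc m) n → Exp s m n
substL0 {m = m} {n} t = substL f
  where f : Fin (suc m) → Exp trm m n
        f zero    = t
        f (suc i) = lv i

substR0 : ∀ {s m n} → Exp ctx m n → Exp s m (suc n) → Exp s m n
substR0 {m = m} {n} e = substR f
  where f : Fin (suc n) → Exp ctx m n
        f zero    = e
        f (suc i) = rv i

data Rule : Set where
  rλ rμ rμ̃ rsl rsr rcl1l rcl1r rcl2 : Rule

-- the rules  (x ∉ Fv(e), α ∉ Fv(t) expressed by weakening)
data Top : ∀ {s m n} → Rule → Exp s m n → Exp s m n → Set where
  λ-rule   : ∀ {m n} (t : Exp trm (suc m) n) (t' : Exp trm m n) (e : Exp ctx m n) →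
             Top rλ (cut (lam t) (push t' e)) (cut t' (mut (cut t (renL suc e))))
  μ-rule   : ∀ {m n} (p : Exp cmd m (suc n)) (e : Exp ctx m n) →
             Top rμ (cut (mu p) e) (substR0 e p)
  μ̃-rule   : ∀ {m n} (t : Exp trm m n) (p : Exp cmd (suc m) n) →
             Top rμ̃ (cut t (mut p)) (substL0 t p)
  sl-rule  : ∀ {m n} (t : Exp trm m n) →
             Top rsl (mu (cut (renR suc t) (rv zero))) t
  sr-rule  : ∀ {m n} (e : Exp ctx m n) →
             Top rsr (mut (cut (lv zero) (renL suc e))) e
  cl1l-rule : ∀ {m n} (t : Exp trm m n) → Top rcl1l (bar (tld t)) t
  cl1r-rule : ∀ {m n} (e : Exp ctx m n) → Top rcl1r (tld (bar e)) e
  cl2-rule  : ∀ {m n} (e : Exp ctx m n) (t : Exp trm m n) →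
              Top rcl2 (cut (bar e) (tld t)) (cut t e)

data Step (r : Rule) : ∀ {s m n} → Exp s m n → Exp s m n → Set where
  top    : ∀ {s m n} {v w : Exp s m n} → Top r v w → Step r v w
  cut-l  : ∀ {m n} {t t' : Exp trm m n} e → Step r t t' → Step r (cut t e) (cut t' e)
  cut-r  : ∀ {m n} {e e' : Exp ctx m n} t → Step r e e' → Step r (cut t e) (cut t e')
  lam-c  : ∀ {m n} {t t' : Exp trm (suc m) n} → Step r t t' → Step r (lam t) (lam t')
  mu-c   : ∀ {m n} {p p' : Exp cmd m (suc n)} → Step r p p' → Step r (mu p) (mu p')
  bar-c  : ∀ {m n} {e e' : Exp ctx m n} → Step r e e' → Step r (bar e) (bar e')
  push-l : ∀ {m n} {t t' : Exp trm m n} e → Step r t t' → Step r (push t e) (push t' e)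
  push-r : ∀ {m n} {e e' : Exp ctx m n} t → Step r e e' → Step r (push t e) (push t e')
  mut-c  : ∀ {m n} {p p' : Exp cmd (suc m) n} → Step r p p' → Step r (mut p) (mut p')
  tld-c  : ∀ {m n} {t t' : Exp trm m n} → Step r t t' → Step r (tld t) (tld t')

data LogicalRule : Rule → Set where
  isλ : LogicalRule rλ
  isμ : LogicalRule rμ
  isμ̃ : LogicalRule rμ̃
  issl : LogicalRule rsl
  issr : LogicalRule rsr

data ClosureRule : Rule → Set where
  iscl1l : ClosureRule rcl1l
  iscl1r : ClosureRule rcl1r
  iscl2  : ClosureRule rcl2

πᵢ : ∀ {k} → Fin 2 → Fin k → Sym k
πᵢ i y = ƛ (sv (suc y) ⋆ σ i (sv zero))

-- environment ρL (l-variables x ↦ x), ρR (r-variables α ↦ ᾱ)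
trE : ∀ {s m n k} → (Fin m → Fin k) → (Fin n → Fin k) → Exp s m n → Sym k
trE ρL ρR (cut v u)   = trE ρL ρR u ⋆ trE ρL ρR v
trE ρL ρR (lv x)      = sv (ρL x)
trE ρL ρR (lam u)     =                       -- λy(λx(π₂(y) ⋆ u^𝔢) ⋆ π₁(y))
  ƛ (ƛ (πᵢ (suc zero) (suc zero) ⋆ trE (extR (λ x → Fin.suc (ρL x))) (λ a → Fin.suc (Fin.suc (ρR a))) u)
     ⋆ πᵢ zero zero)
trE ρL ρR (mu p)      = ƛ (trE (λ x → Fin.suc (ρL x)) (extR ρR) p)
trE ρL ρR (bar h)     = trE ρL ρR h
trE ρL ρR (rv a)      = sv (ρR a)
trE ρL ρR (push t h)  = ⟨ trE ρL ρR t , trE ρL ρR h ⟩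
trE ρL ρR (mut p)     = ƛ (trE (extR ρL) (λ a → Fin.suc (ρR a)) p)
trE ρL ρR (tld u)     = trE ρL ρR u

-- top-level translation: the m l-variables and the n variables ᾱ are
-- distinct variables of λSym_Prop
_ᵉ : ∀ {s m n} → Exp s m n → Sym (m + n)
_ᵉ {m = m} {n} v = trE (λ x → x ↑ˡ n) (λ a → m ↑ʳ a) v

module Submission where

-- The translation is computed by  trE ρL ρR , which interprets the free l- and
-- r-variables through two environments; the theorem is proved for arbitrary
-- environments, which is what makes the induction go through under binders.
--
-- 1. Both relations in the conclusion, ⟶⁺ and ∼, are closed under one-hole
--    contexts of λSym_Prop.  Since the translation is compositional, every
--    congruence step of λ̄μμ̃* is then simulated as soon as the redex itself is
--    ( step-simulation ).
-- 2. The translation commutes with renaming and substitution, on both the l-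
--    and the r-side ( trE-renL, trE-renR, trE-sub-var, ren-trE, trE-substL,
--    trE-substR ).  This is the bookkeeping behind the
--    redex cases.
-- 3. Redexes: μ and μ̃ become one β-step, s_l and s_r one η-step, and the λ-rule
--    becomes a β-step followed by two projections  πᵢ ⟨P₁,P₂⟩ ⟶⁺ Pᵢ  ( π-pair ).
--    The closure rules cl₁ disappear under the translation and cl₂ swaps the
--    two sides of a ⋆, so they are simulated by ∼.

open import Defs
open import Data.Product using (_×_; _,_)
open import Data.Nat using (suc)
open import Data.Fin using (Fin; zero; suc)
open import Function using (_∘_)
open import Relation.Binary.PropositionalEquality using (_≡_; refl; cong; cong₂; sym; trans)
open import Relation.Binary.Construct.Closure.Transitive using ([_]; _∷_; _++_)

SymRel : Set₁
SymRel = ∀ {k} → Sym k → Sym k → Set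

Compatible : SymRel → Set
Compatible R = ∀ {k k'} (E : SCtx k k') {P Q : Sym k'} → R P Q → R (plug E P) (plug E Q)

plug-⟶ : ∀ {k k'} (E : SCtx k k') {P Q : Sym k'} → P ⟶ Q → plug E P ⟶ plug E Q
plug-⟶ hole        s = s
plug-⟶ (ƛC E)      s = ƛ-c (plug-⟶ E s)
plug-⟶ (pairL E Q) s = pairl Q (plug-⟶ E s)
plug-⟶ (pairR Q E) s = pairr Q (plug-⟶ E s)
plug-⟶ (σC i E)    s = σ-c i (plug-⟶ E s)
plug-⟶ (starL E Q) s = starl Q (plug-⟶ E s)
plug-⟶ (starR Q E) s = starr Q (plug-⟶ E s)

plug-⟶⁺ : Compatible _⟶⁺_
plug-⟶⁺ E [ s ]    = [ plug-⟶ E s ]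
plug-⟶⁺ E (s ∷ ss) = plug-⟶ E s ∷ plug-⟶⁺ E ss

-- ∼ is reflexive, hence (being a congruence) compatible.
∼-refl : ∀ {k} (P : Sym k) → P ∼ P
∼-refl (sv x)    = var∼ x
∼-refl ⟨ P , Q ⟩ = pair∼ (∼-refl P) (∼-refl Q)
∼-refl (σ i P)   = σ∼ i (∼-refl P)
∼-refl (ƛ P)     = ƛ∼ (∼-refl P)
∼-refl (P ⋆ Q)   = star∼ (∼-refl P) (∼-refl Q)

plug-∼ : Compatible _∼_
plug-∼ hole        s = s
plug-∼ (ƛC E)      s = ƛ∼ (plug-∼ E s)
plug-∼ (pairL E Q) s = pair∼ (plug-∼ E s) (∼-refl Q)
plug-∼ (pairR Q E) s = pair∼ (∼-refl Q) (plug-∼ E s)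
plug-∼ (σC i E)    s = σ∼ i (plug-∼ E s)
plug-∼ (starL E Q) s = star∼ (plug-∼ E s) (∼-refl Q)
plug-∼ (starR Q E) s = star∼ (∼-refl Q) (plug-∼ E s)

-- The context  λy(λx(π₂(y) ⋆ [-]) ⋆ π₁(y))  in which the translation of λx u
-- places the translation of u.
λ-ctx : ∀ {k} → SCtx k (suc (suc k))
λ-ctx = ƛC (starL (ƛC (starR (πᵢ (suc zero) (suc zero)) hole)) (πᵢ zero zero))

-- A rule r is simulated in R at the root for all environments ...
RootSimulated : Rule → SymRel → Set
RootSimulated r R = ∀ {s m n k} (ρL : Fin m → Fin k) (ρR : Fin n → Fin k) {v w : Exp s m n} →
                    Top r v w → R (trE ρL ρR v) (trE ρL ρR w)

-- ... hence everywhere, if R is compatible: the translation is compositional,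
-- so a step inside a λ̄μμ̃* constructor becomes a step inside a context.
module _ {r} (R : SymRel) (plugR : Compatible R) (root : RootSimulated r R) where

  step-simulation : ∀ {s m n k} (ρL : Fin m → Fin k) (ρR : Fin n → Fin k) {v w : Exp s m n} →
                    Step r v w → R (trE ρL ρR v) (trE ρL ρR w)
  step-simulation ρL ρR (top x)       = root ρL ρR x
  step-simulation ρL ρR (cut-l e st)  = plugR (starR (trE ρL ρR e) hole) (step-simulation ρL ρR st)
  step-simulation ρL ρR (cut-r t st)  = plugR (starL hole (trE ρL ρR t)) (step-simulation ρL ρR st)
  step-simulation ρL ρR (lam-c st)    = plugR λ-ctx (step-simulation _ _ st)
  step-simulation ρL ρR (mu-c st)     = plugR (ƛC hole) (step-simulation _ _ st)
  step-simulation ρL ρR (bar-c st)    = step-simulation ρL ρR st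
  step-simulation ρL ρR (push-l e st) = plugR (pairL hole (trE ρL ρR e)) (step-simulation ρL ρR st)
  step-simulation ρL ρR (push-r t st) = plugR (pairR (trE ρL ρR t) hole) (step-simulation ρL ρR st)
  step-simulation ρL ρR (mut-c st)    = plugR (ƛC hole) (step-simulation _ _ st)
  step-simulation ρL ρR (tld-c st)    = step-simulation ρL ρR st

-- How renamings and substitutions act on environments.  Each relation is a
-- record, so that the environments it relates can be inferred by unification.

record RenEnv {a b k} (f : Fin a → Fin b) (ρ : Fin b → Fin k) (ρ' : Fin a → Fin k) : Set where
  constructor renEnv
  field ren-at : ∀ x → ρ (f x) ≡ ρ' x
open RenEnv

suc-RenEnv : ∀ {a b k} {f : Fin a → Fin b} {ρ : Fin b → Fin k} {ρ' : Fin a → Fin k} →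
             RenEnv f ρ ρ' → RenEnv f (suc ∘ ρ) (suc ∘ ρ')
suc-RenEnv h = renEnv (cong suc ∘ ren-at h)

extR-RenEnv : ∀ {a b k} {f : Fin a → Fin b} {ρ : Fin b → Fin k} {ρ' : Fin a → Fin k} →
              RenEnv f ρ ρ' → RenEnv (extR f) (extR ρ) (extR ρ')
extR-RenEnv h = renEnv λ { zero → refl ; (suc x) → cong suc (ren-at h x) }

trE-renL : ∀ {s m m' n k} {f : Fin m → Fin m'} {ρL : Fin m' → Fin k} {ρL' : Fin m → Fin k} {ρR : Fin n → Fin k} →
           RenEnv f ρL ρL' → (u : Exp s m n) → trE ρL ρR (renL f u) ≡ trE ρL' ρR u
trE-renL hL (cut v u)  = cong₂ _⋆_ (trE-renL hL u) (trE-renL hL v)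
trE-renL hL (lv x)     = cong sv (ren-at hL x)
trE-renL hL (lam u)    = cong (plug λ-ctx) (trE-renL (extR-RenEnv (suc-RenEnv hL)) u)
trE-renL hL (mu p)     = cong ƛ (trE-renL (suc-RenEnv hL) p)
trE-renL hL (bar h)    = trE-renL hL h
trE-renL hL (rv a)     = refl
trE-renL hL (push t h) = cong₂ ⟨_,_⟩ (trE-renL hL t) (trE-renL hL h)
trE-renL hL (mut p)    = cong ƛ (trE-renL (extR-RenEnv hL) p)
trE-renL hL (tld u)    = trE-renL hL u

trE-renR : ∀ {s m n n' k} {f : Fin n → Fin n'} {ρL : Fin m → Fin k} {ρR : Fin n' → Fin k} {ρR' : Fin n → Fin k} →
           RenEnv f ρR ρR' → (u : Exp s m n) → trE ρL ρR (renR f u) ≡ trE ρL ρR' u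
trE-renR hR (cut v u)  = cong₂ _⋆_ (trE-renR hR u) (trE-renR hR v)
trE-renR hR (lv x)     = refl
trE-renR hR (lam u)    = cong (plug λ-ctx) (trE-renR (suc-RenEnv (suc-RenEnv hR)) u)
trE-renR hR (mu p)     = cong ƛ (trE-renR (extR-RenEnv hR) p)
trE-renR hR (bar h)    = trE-renR hR h
trE-renR hR (rv a)     = cong sv (ren-at hR a)
trE-renR hR (push t h) = cong₂ ⟨_,_⟩ (trE-renR hR t) (trE-renR hR h)
trE-renR hR (mut p)    = cong ƛ (trE-renR (suc-RenEnv hR) p)
trE-renR hR (tld u)    = trE-renR hR u

trE-wkL : ∀ {s m n k} {ρL : Fin (suc m) → Fin k} {ρR : Fin n → Fin k} (u : Exp s m n) →
          trE ρL ρR (renL suc u) ≡ trE (ρL ∘ suc) ρR u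
trE-wkL = trE-renL (renEnv λ _ → refl)

trE-wkR : ∀ {s m n k} {ρL : Fin m → Fin k} {ρR : Fin (suc n) → Fin k} (u : Exp s m n) →
          trE ρL ρR (renR suc u) ≡ trE ρL (ρR ∘ suc) u
trE-wkR = trE-renR (renEnv λ _ → refl)

record VarSub {a k k'} (sb : Fin k → Sym k') (ρ' : Fin a → Fin k) (ρ : Fin a → Fin k') : Set where
  constructor varSub
  field var-at : ∀ x → sb (ρ' x) ≡ sv (ρ x)
open VarSub

suc-VarSub : ∀ {a k k'} {sb : Fin k → Sym k'} {ρ' : Fin a → Fin k} {ρ : Fin a → Fin k'} →
             VarSub sb ρ' ρ → VarSub (exts sb) (suc ∘ ρ') (suc ∘ ρ)
suc-VarSub h = varSub (cong (ren suc) ∘ var-at h)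

extR-VarSub : ∀ {a k k'} {sb : Fin k → Sym k'} {ρ' : Fin a → Fin k} {ρ : Fin a → Fin k'} →
              VarSub sb ρ' ρ → VarSub (exts sb) (extR ρ') (extR ρ)
extR-VarSub h = varSub λ { zero → refl ; (suc x) → cong (ren suc) (var-at h x) }

trE-sub-var : ∀ {s m n k k'} {sb : Fin k → Sym k'} {ρL' : Fin m → Fin k} {ρR' : Fin n → Fin k}
              {ρL : Fin m → Fin k'} {ρR : Fin n → Fin k'} →
              VarSub sb ρL' ρL → VarSub sb ρR' ρR → (u : Exp s m n) → sub sb (trE ρL' ρR' u) ≡ trE ρL ρR u
trE-sub-var hL hR (cut v u)  = cong₂ _⋆_ (trE-sub-var hL hR u) (trE-sub-var hL hR v)
trE-sub-var hL hR (lv x)     = var-at hL x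
trE-sub-var hL hR (lam u)    =
  cong (plug λ-ctx) (trE-sub-var (extR-VarSub (suc-VarSub hL)) (suc-VarSub (suc-VarSub hR)) u)
trE-sub-var hL hR (mu p)     = cong ƛ (trE-sub-var (suc-VarSub hL) (extR-VarSub hR) p)
trE-sub-var hL hR (bar h)    = trE-sub-var hL hR h
trE-sub-var hL hR (rv a)     = var-at hR a
trE-sub-var hL hR (push t h) = cong₂ ⟨_,_⟩ (trE-sub-var hL hR t) (trE-sub-var hL hR h)
trE-sub-var hL hR (mut p)    = cong ƛ (trE-sub-var (extR-VarSub hL) (suc-VarSub hR) p)
trE-sub-var hL hR (tld u)    = trE-sub-var hL hR u

ren-as-sub : ∀ {k k'} (f : Fin k → Fin k') {g : Fin k → Sym k'} →
             (∀ i → g i ≡ sv (f i)) → (P : Sym k) → ren f P ≡ sub g P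
ren-as-sub f eq (sv x)    = sym (eq x)
ren-as-sub f eq ⟨ P , Q ⟩ = cong₂ ⟨_,_⟩ (ren-as-sub f eq P) (ren-as-sub f eq Q)
ren-as-sub f eq (σ i P)   = cong (σ i) (ren-as-sub f eq P)
ren-as-sub f eq (ƛ P)     = cong ƛ (ren-as-sub (extR f) exts-eq P)
  where exts-eq : ∀ i → exts _ i ≡ sv (extR f i)
        exts-eq zero    = refl
        exts-eq (suc i) = cong (ren suc) (eq i)
ren-as-sub f eq (P ⋆ Q)   = cong₂ _⋆_ (ren-as-sub f eq P) (ren-as-sub f eq Q)

ren-trE : ∀ {s m n k k'} (f : Fin k → Fin k') {ρL : Fin m → Fin k} {ρR : Fin n → Fin k} (u : Exp s m n) →
          ren f (trE ρL ρR u) ≡ trE (f ∘ ρL) (f ∘ ρR) u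
ren-trE f u = trans (ren-as-sub f (λ _ → refl) _) (trE-sub-var (varSub λ _ → refl) (varSub λ _ → refl) u)

record TrmSub {s a m n k k'} (sb : Fin k → Sym k') (ρ' : Fin a → Fin k)
              (ρL : Fin m → Fin k') (ρR : Fin n → Fin k') (σ' : Fin a → Exp s m n) : Set where
  constructor trmSub
  field trm-at : ∀ x → sb (ρ' x) ≡ trE ρL ρR (σ' x)
open TrmSub

-- Under a binder of λSym_Prop the translations are weakened; on the λ̄μμ̃*
-- side this is mirrored by weakening σ' by renL suc or renR suc, or, when the
-- binder is also one of λ̄μμ̃*, by extending σ' with extsL or extsR.

suc-TrmSub : ∀ {s a m n k k'} {sb : Fin k → Sym k'} {ρ' : Fin a → Fin k} {ρL : Fin m → Fin k'}
             {ρR : Fin n → Fin k'} {σ' : Fin a → Exp s m n} →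
             TrmSub sb ρ' ρL ρR σ' → TrmSub (exts sb) (suc ∘ ρ') (suc ∘ ρL) (suc ∘ ρR) σ'
suc-TrmSub {σ' = σ'} h = trmSub λ x → trans (cong (ren suc) (trm-at h x)) (ren-trE suc (σ' x))

wkL-TrmSub : ∀ {s a m n k k'} {sb : Fin k → Sym k'} {ρ' : Fin a → Fin k} {ρL : Fin m → Fin k'}
             {ρR : Fin n → Fin k'} {σ' : Fin a → Exp s m n} →
             TrmSub sb ρ' ρL ρR σ' → TrmSub (exts sb) (suc ∘ ρ') (extR ρL) (suc ∘ ρR) (renL suc ∘ σ')
wkL-TrmSub {σ' = σ'} h = trmSub λ x → trans (trm-at (suc-TrmSub h) x) (sym (trE-wkL (σ' x)))

wkR-TrmSub : ∀ {s a m n k k'} {sb : Fin k → Sym k'} {ρ' : Fin a → Fin k} {ρL : Fin m → Fin k'}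
             {ρR : Fin n → Fin k'} {σ' : Fin a → Exp s m n} →
             TrmSub sb ρ' ρL ρR σ' → TrmSub (exts sb) (suc ∘ ρ') (suc ∘ ρL) (extR ρR) (renR suc ∘ σ')
wkR-TrmSub {σ' = σ'} h = trmSub λ x → trans (trm-at (suc-TrmSub h) x) (sym (trE-wkR (σ' x)))

extsL-TrmSub : ∀ {a m n k k'} {sb : Fin k → Sym k'} {ρ' : Fin a → Fin k} {ρL : Fin m → Fin k'}
               {ρR : Fin n → Fin k'} {σ' : Fin a → Exp trm m n} →
               TrmSub sb ρ' ρL ρR σ' → TrmSub (exts sb) (extR ρ') (extR ρL) (suc ∘ ρR) (extsL σ')
extsL-TrmSub h = trmSub λ { zero → refl ; (suc x) → trm-at (wkL-TrmSub h) x }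

extsR-TrmSub : ∀ {a m n k k'} {sb : Fin k → Sym k'} {ρ' : Fin a → Fin k} {ρL : Fin m → Fin k'}
               {ρR : Fin n → Fin k'} {σ' : Fin a → Exp ctx m n} →
               TrmSub sb ρ' ρL ρR σ' → TrmSub (exts sb) (extR ρ') (suc ∘ ρL) (extR ρR) (extsR σ')
extsR-TrmSub h = trmSub λ { zero → refl ; (suc x) → trm-at (wkR-TrmSub h) x }

trE-substL : ∀ {s m m' n k k'} {sb : Fin k → Sym k'} {σ' : Fin m → Exp trm m' n}
             {ρL' : Fin m → Fin k} {ρR' : Fin n → Fin k} {ρL : Fin m' → Fin k'} {ρR : Fin n → Fin k'} →
             TrmSub sb ρL' ρL ρR σ' → VarSub sb ρR' ρR →
             (u : Exp s m n) → sub sb (trE ρL' ρR' u) ≡ trE ρL ρR (substL σ' u)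
trE-substL hL hR (cut v u)  = cong₂ _⋆_ (trE-substL hL hR u) (trE-substL hL hR v)
trE-substL hL hR (lv x)     = trm-at hL x
trE-substL hL hR (lam u)    =
  cong (plug λ-ctx) (trE-substL (extsL-TrmSub (suc-TrmSub hL)) (suc-VarSub (suc-VarSub hR)) u)
trE-substL hL hR (mu p)     = cong ƛ (trE-substL (wkR-TrmSub hL) (extR-VarSub hR) p)
trE-substL hL hR (bar h)    = trE-substL hL hR h
trE-substL hL hR (rv a)     = var-at hR a
trE-substL hL hR (push t h) = cong₂ ⟨_,_⟩ (trE-substL hL hR t) (trE-substL hL hR h)
trE-substL hL hR (mut p)    = cong ƛ (trE-substL (extsL-TrmSub hL) (suc-VarSub hR) p)
trE-substL hL hR (tld u)    = trE-substL hL hR u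

trE-substR : ∀ {s m n n' k k'} {sb : Fin k → Sym k'} {σ' : Fin n → Exp ctx m n'}
             {ρL' : Fin m → Fin k} {ρR' : Fin n → Fin k} {ρL : Fin m → Fin k'} {ρR : Fin n' → Fin k'} →
             VarSub sb ρL' ρL → TrmSub sb ρR' ρL ρR σ' →
             (u : Exp s m n) → sub sb (trE ρL' ρR' u) ≡ trE ρL ρR (substR σ' u)
trE-substR hL hR (cut v u)  = cong₂ _⋆_ (trE-substR hL hR u) (trE-substR hL hR v)
trE-substR hL hR (lv x)     = var-at hL x
trE-substR hL hR (lam u)    =
  cong (plug λ-ctx) (trE-substR (extR-VarSub (suc-VarSub hL)) (wkL-TrmSub (suc-TrmSub hR)) u)
trE-substR hL hR (mu p)     = cong ƛ (trE-substR (suc-VarSub hL) (extsR-TrmSub hR) p)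
trE-substR hL hR (bar h)    = trE-substR hL hR h
trE-substR hL hR (rv a)     = trm-at hR a
trE-substR hL hR (push t h) = cong₂ ⟨_,_⟩ (trE-substR hL hR t) (trE-substR hL hR h)
trE-substR hL hR (mut p)    = cong ƛ (trE-substR (extR-VarSub hL) (wkL-TrmSub hR) p)
trE-substR hL hR (tld u)    = trE-substR hL hR u

⟶⁺-source : ∀ {k} {P Q R : Sym k} → P ≡ Q → Q ⟶⁺ R → P ⟶⁺ R
⟶⁺-source refl s = s

⟶⁺-target : ∀ {k} {P Q R : Sym k} → P ⟶⁺ Q → Q ≡ R → P ⟶⁺ R
⟶⁺-target s refl = s

-- πᵢ applied to a pair projects:  λz(⟨P₁,P₂⟩ ⋆ σᵢ(z)) ⟶ λz(Pᵢ ⋆ z) ⟶ Pᵢ .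
π-pair : ∀ {k} (i : Fin 2) (P₁ P₂ : Sym k) → ƛ (ren suc ⟨ P₁ , P₂ ⟩ ⋆ σ i (sv zero)) ⟶⁺ pick i P₁ P₂
π-pair zero    P₁ P₂ = ƛ-c (top (πl zero _ _ _)) ∷ [ top (ηl P₁) ]
π-pair (suc i) P₁ P₂ = ƛ-c (top (πl (suc i) _ _ _)) ∷ [ top (ηl P₂) ]

-- The λ-rule:  ⟨t',e⟩ ⋆ λy(λx(π₂(y) ⋆ t) ⋆ π₁(y))  β-reduces with y := ⟨t',e⟩,
-- then π₁ projects out t' and π₂ projects out e, leaving  λx(e ⋆ t) ⋆ t' .
simulate-λ : ∀ {m n k} (ρL : Fin m → Fin k) (ρR : Fin n → Fin k)
             (t : Exp trm (suc m) n) (t' : Exp trm m n) (e : Exp ctx m n) →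
             trE ρL ρR (cut (lam t) (push t' e)) ⟶⁺ trE ρL ρR (cut t' (mut (cut t (renL suc e))))
simulate-λ ρL ρR t t' e =
  ⟶⁺-target (top (βr _ ⟨ T' , E ⟩)
               ∷ plug-⟶⁺ (starR _ hole) (π-pair zero T' E)
               ++ plug-⟶⁺ (starL (ƛC (starL hole B)) T') (π-pair (suc zero) (ren suc T') (ren suc E)))
            (cong (λ X → ƛ X ⋆ T') (cong₂ _⋆_ E-eq B-eq))
  where
    T' = trE ρL ρR t'
    E  = trE ρL ρR e
    B  = sub (exts (sub0 ⟨ T' , E ⟩)) (trE (extR (suc ∘ ρL)) (λ a → suc (suc (ρR a))) t)

    E-eq : ren suc E ≡ trE (extR ρL) (suc ∘ ρR) (renL suc e)
    E-eq = trans (ren-trE suc e) (sym (trE-wkL e))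

    B-eq : B ≡ trE (extR ρL) (suc ∘ ρR) t
    B-eq = trE-sub-var (extR-VarSub (varSub λ _ → refl)) (suc-VarSub (varSub λ _ → refl)) t

-- The logical rules are simulated by at least one reduction step: μ and μ̃ by
-- a β-step whose substitution realises α := e resp. x := t, and s_l, s_r by
-- an η-step, the bound variable not occurring in the weakened body.
logical-root : ∀ {r} → LogicalRule r → RootSimulated r _⟶⁺_
logical-root isλ  ρL ρR (λ-rule t t' e) = simulate-λ ρL ρR t t' e
logical-root isμ  ρL ρR (μ-rule p e)    =
  ⟶⁺-target [ top (βr _ _) ] (trE-substR (varSub λ _ → refl) (trmSub λ { zero → refl ; (suc a) → refl }) p)
logical-root isμ̃  ρL ρR (μ̃-rule t p)    =
  ⟶⁺-target [ top (βl _ _) ] (trE-substL (trmSub λ { zero → refl ; (suc x) → refl }) (varSub λ _ → refl) p)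
logical-root issl ρL ρR (sl-rule t)     =
  ⟶⁺-source (cong (λ X → ƛ (sv zero ⋆ X)) (trans (trE-wkR t) (sym (ren-trE suc t)))) [ top (ηr _) ]
logical-root issr ρL ρR (sr-rule e)     =
  ⟶⁺-source (cong (λ X → ƛ (X ⋆ sv zero)) (trans (trE-wkL e) (sym (ren-trE suc e)))) [ top (ηl _) ]

-- The closure rules: cl₁ is invisible after translation, cl₂ swaps a ⋆.
closure-root : ∀ {r} → ClosureRule r → RootSimulated r _∼_
closure-root iscl1l ρL ρR (cl1l-rule t)  = ∼-refl _
closure-root iscl1r ρL ρR (cl1r-rule e)  = ∼-refl _
closure-root iscl2  ρL ρR (cl2-rule e t) = swap∼ (∼-refl _) (∼-refl _)

theorem4p6 : (∀ {s m n} (r : Rule) → LogicalRule r → (v w : Exp s m n) → Step r v w → (v ᵉ) ⟶⁺ (w ᵉ))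
    × (∀ {s m n} (r : Rule) → ClosureRule r → (v w : Exp s m n) → Step r v w → (v ᵉ) ∼ (w ᵉ))
theorem4p6 =
  (λ r logical v w → step-simulation _⟶⁺_ plug-⟶⁺ (logical-root logical) _ _) ,
  (λ r closure v w → step-simulation _∼_ plug-∼ (closure-root closure) _ _)
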